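{- Suppose $G$ is an $(r,t)$-RS graph on $n$ vertices. Then \[ r \leq \begin{cases} \dfrac{n}{4}\left(1+\dfrac{1}{t}\right) & \text{if $t$ is odd,}\\[2mm] \dfrac{n}{4}\left(1+\dfrac{1}{t+1}\right) & \text{if $t$ is even.} \end{cases} \] Moreover, these upper bounds on $r$ are tight for every positive integer $t$ and infinitely many $n$.
   Context: A graph $G$ is called an $(r,t)$-Ruzsa-Szemerédi graph (or $(r,t)$-RS graph) if its edge set can be partitioned into $t$ pairwise edge-disjoint induced matchings, each consisting of exactly $r$ edges. -}

module Defs where

open import Data.Nat using (ℕ; suc; _+_; _*_; _≤_; _%_)
open import Data.Fin using (Fin)
open import Data.Product using (Σ; ∃; _×_; _,_; proj₁; proj₂)
open import Data.Sum using (_⊎_)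
open import Relation.Nullary using (¬_)
open import Relation.Binary.PropositionalEquality using (_≡_; _≢_)

record Graph (n : ℕ) : Set₁ where
  field
    Adj    : Fin n → Fin n → Set
    sym    : ∀ {u v} → Adj u v → Adj v u
    irrefl : ∀ {u} → ¬ Adj u u
open Graph public

Edge : ℕ → Set
Edge n = Fin n × Fin n

Ends : ∀ {n} → Edge n → Fin n → Set
Ends e v = v ≡ proj₁ e ⊎ v ≡ proj₂ e

SameEdge : ∀ {n} → Edge n → Edge n → Set
SameEdge (a , b) (c , d) = (a ≡ c × b ≡ d) ⊎ (a ≡ d × b ≡ c)

-- M is a family of t lists of r edges each, M i j being the j-th edge of
-- the i-th matching, forming a partition of E(G) into t pairwise
-- edge-disjoint induced matchings of size exactly r.
record IsRSPartition {n : ℕ} (G : Graph n) (r t : ℕ)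
                     (M : Fin t → Fin r → Edge n) : Set where
  field
    inG      : ∀ i j → Adj G (proj₁ (M i j)) (proj₂ (M i j))
    matching : ∀ i j k → j ≢ k → ∀ v → Ends (M i j) v → ¬ Ends (M i k) v
    induced  : ∀ i j k → j ≢ k → ∀ u v →
               Ends (M i j) u → Ends (M i k) v → ¬ Adj G u v
    disjoint : ∀ i i' j j' → i ≢ i' → ¬ SameEdge (M i j) (M i' j')
    cover    : ∀ u v → Adj G u v → ∃ λ i → ∃ λ j → SameEdge (M i j) (u , v)

IsRS : ∀ {n} → Graph n → ℕ → ℕ → Set
IsRS {n} G r t = ∃ λ (M : Fin t → Fin r → Edge n) → IsRSPartition G r t M

-- r ≤ (n/4)(1 + 1/t) for t odd, r ≤ (n/4)(1 + 1/(t+1)) for t even,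
-- with denominators cleared.
RSBound : ℕ → ℕ → ℕ → Set
RSBound n r t =
  (t % 2 ≡ 1 → 4 * t * r ≤ n * (t + 1)) ×
  (t % 2 ≡ 0 → 4 * (t + 1) * r ≤ n * (t + 2))

RSBoundAttained : ℕ → ℕ → ℕ → Set
RSBoundAttained n r t =
  (t % 2 ≡ 1 → 4 * t * r ≡ n * (t + 1)) ×
  (t % 2 ≡ 0 → 4 * (t + 1) * r ≡ n * (t + 2))

module Submission where

-- Let d(v) be the degree of v and let an edge uv belong to the matching M_i.
-- Every other matching M_i′ covers at most one of u, v (two covering edges would be joined
-- by uv, against inducedness, or coincide with uv, against disjointness), and M_i covers
-- each exactly once, so d(u) + d(v) ≤ t + 1.  Double counting gives Σ d = 2tr and
-- Σ d² = Σ_{uv} (d(u) + d(v)) ≤ tr(t + 1).  If a + (a + s) = t + 1 with s ≤ 1, no natural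
-- number lies strictly between a and a + s, so (t + 1) x ≤ x² + a(a + s) for every x;
-- summing over the vertices gives the uniform bound t r (t + 1) ≤ n a (a + s), which for
-- t odd (a = a + s = (t + 1)/2) and t even (a = t/2, s = 1) is the stated one.
--
-- Vertices are triples (L, b, x): L ∈ {0,1}^t with a or a + s ones, a side
-- b and a copy x among m.  For L_i = 1 the vertex is joined to its partner across i,
-- (L′, ¬b, x) with L′_i = 1 and L′ the complement of L elsewhere; these edges form the
-- matching M_i.  Every vertex has degree |L| ∈ {a, a + s} and every edge has degree sum
-- t + 1, so each inequality above is an equality.

open import Defs hiding (sym)
open import Data.Nat using (ℕ; zero; suc; _+_; _*_; _%_; _≤_; z≤n; s≤s; _≤?_) renaming (_≟_ to _≟ℕ_)
open import Data.Nat.Properties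
  using (+-mono-≤; +-monoˡ-≤; +-monoʳ-≤; *-monoʳ-≤; ≤-refl; ≤-trans; m≤m+n; m≤n+m; m≤m*n; n≤1+n;
         n<1⇒n≡0; ≰⇒>; m≤n⇒∃[o]m+o≡n; +-comm; +-identityʳ; *-zeroʳ; *-identityʳ; *-distribʳ-+;
         +-cancelˡ-≤; +-cancelˡ-≡; +-cancelʳ-≡; *-cancelˡ-≤; *-cancelˡ-≡; +-*-semiring; module ≤-Reasoning)
open import Data.Nat.DivMod using ([m+kn]%n≡m%n; m*n%n≡0)
open import Data.Nat.Tactic.RingSolver using (solve-∀)
open import Data.Fin using (Fin; zero; suc; punchIn)
open import Data.Fin.Properties using (punchInᵢ≢i; suc-injective; injective⇒≤) renaming (_≟_ to _≟ᶠ_)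
open import Data.Fin.Permutation using (Permutation; transpose; _⟨$⟩ʳ_; inverseˡ; inverseʳ; flip)
open import Data.Bool using (Bool; true; false; not; if_then_else_) renaming (_≟_ to _≟ᵇ_)
open import Data.Bool.Properties using (not-involutive)
open import Data.Vec using (Vec; []; _∷_; lookup; tabulate; replicate)
open import Data.Vec.Properties using (lookup∘tabulate; ∷-injective)
open import Data.Vec.Relation.Binary.Pointwise.Extensional using (ext; Pointwise-≡⇒≡)
open import Data.List using (List; []; _∷_; length; filter; allFin; cartesianProduct; cartesianProductWith)
import Data.List as List
import Data.List.Relation.Unary.All as All
open import Data.List.Relation.Unary.AllPairs using ([]; _∷_)
open import Data.List.Relation.Unary.Any using (here; there)
import Data.List.Relation.Unary.Any as Any
open import Data.List.Relation.Unary.Any.Properties using (lookup-index)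
open import Data.List.Relation.Unary.Unique.Propositional using (Unique)
import Data.List.Relation.Unary.Unique.Propositional.Properties as Unique
open import Data.List.Membership.Propositional using (_∈_)
open import Data.List.Membership.Propositional.Properties
  using (∈-filter⁺; ∈-filter⁻; ∈-cartesianProduct⁺; ∈-cartesianProductWith⁺; ∈-allFin; ∈-lookup)
open import Data.Product using (Σ; ∃; _×_; _,_; proj₁; proj₂)
import Data.Product as Product
open import Data.Sum using (_⊎_; inj₁; inj₂)
open import Data.Empty using (⊥; ⊥-elim)
open import Relation.Nullary using (¬_; does; yes; no; _×-dec_; _⊎-dec_)
open import Relation.Nullary.Decidable using (dec-true; dec-false)
open import Relation.Unary using (Decidable)
open import Relation.Binary.PropositionalEquality
open import Algebra.Properties.Semiring.Sum +-*-semiring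
  using (sum; sum-cong-≗; sum-remove; ∑-distrib-+; ∑-comm; ∑-permute; *-distribˡ-sum; *-distribʳ-sum)

sum-mono-≤ : ∀ {n} {f g : Fin n → ℕ} → (∀ i → f i ≤ g i) → sum f ≤ sum g
sum-mono-≤ {zero}  f≤g = z≤n
sum-mono-≤ {suc n} f≤g = +-mono-≤ (f≤g zero) (sum-mono-≤ (λ i → f≤g (suc i)))

sum-const : ∀ n c → sum {n} (λ _ → c) ≡ n * c
sum-const zero    c = refl
sum-const (suc n) c = cong (c +_) (sum-const n c)

sum-const₂ : ∀ t r c → sum {t} (λ _ → sum {r} (λ _ → c)) ≡ t * (r * c)
sum-const₂ t r c = trans (sum-cong-≗ {t} (λ _ → sum-const r c)) (sum-const t (r * c))

term-≤-sum : ∀ {n} (f : Fin n → ℕ) j → f j ≤ sum f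
term-≤-sum f zero    = m≤m+n (f zero) _
term-≤-sum f (suc j) = ≤-trans (term-≤-sum (λ k → f (suc k)) j) (m≤n+m _ (f zero))

sum-positive : ∀ {n} (f : Fin n → ℕ) → 1 ≤ sum f → ∃ λ j → 1 ≤ f j
sum-positive {suc n} f pos with 1 ≤? f zero
... | yes p     = zero , p
... | no f₀≱1 = Product.map suc (λ p → p) (sum-positive (λ j → f (suc j)) rest-positive)
  where
  rest-positive : 1 ≤ sum (λ j → f (suc j))
  rest-positive = subst (λ x → 1 ≤ x + sum (λ j → f (suc j))) (n<1⇒n≡0 (≰⇒> f₀≱1)) pos

exclusive-≤1 : ∀ {x y} → x ≤ 1 → y ≤ 1 → (1 ≤ x → 1 ≤ y → ⊥) → x + y ≤ 1
exclusive-≤1 {zero}                 _        y≤1 _    = y≤1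
exclusive-≤1 {suc zero}    {zero}   _        _   _    = s≤s z≤n
exclusive-≤1 {suc zero}    {suc _}  _        _   both = ⊥-elim (both (s≤s z≤n) (s≤s z≤n))
exclusive-≤1 {suc (suc _)}          (s≤s ()) _   _

sum-≤1 : ∀ {n} (f : Fin n → ℕ) → (∀ j → f j ≤ 1) →
         (∀ j k → 1 ≤ f j → 1 ≤ f k → j ≡ k) → sum f ≤ 1
sum-≤1 {zero}  f _  _   = z≤n
sum-≤1 {suc n} f ≤1 one = exclusive-≤1 (≤1 zero) rest-≤1 zero-alone
  where
  rest-≤1 : sum (λ j → f (suc j)) ≤ 1
  rest-≤1 = sum-≤1 (λ j → f (suc j)) (λ j → ≤1 (suc j)) (λ j k p q → suc-injective (one (suc j) (suc k) p q))
  zero-alone : 1 ≤ f zero → 1 ≤ sum (λ j → f (suc j)) → ⊥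
  zero-alone p q with sum-positive (λ j → f (suc j)) q
  ... | j , r with () ← one zero (suc j) p r

sum-single : ∀ {n} (f : Fin n → ℕ) a → (∀ v → v ≢ a → f v ≡ 0) → sum f ≡ f a
sum-single {suc n} f a zero-off = begin
  sum f                               ≡⟨ sum-remove f ⟩
  f a + sum (λ k → f (punchIn a k))   ≡⟨ cong (f a +_) (sum-cong-≗ (λ k → zero-off _ (punchInᵢ≢i a k))) ⟩
  f a + sum {n} (λ _ → 0)             ≡⟨ cong (f a +_) (trans (sum-const n 0) (*-zeroʳ n)) ⟩
  f a + 0                             ≡⟨ +-identityʳ (f a) ⟩
  f a                                 ∎
  where open ≡-Reasoning

indicator : Bool → ℕ
indicator true  = 1
indicator false = 0

indicator-of : ∀ {x} b → x ≤ 1 → (1 ≤ x → b ≡ true) → (b ≡ true → 1 ≤ x) → x ≡ indicator b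
indicator-of {zero}        false _        _ _ = refl
indicator-of {zero}        true  _        _ ⇐ with () ← ⇐ refl
indicator-of {suc zero}    true  _        _ _ = refl
indicator-of {suc zero}    false _        ⇒ _ with () ← ⇒ (s≤s z≤n)
indicator-of {suc (suc _)} _     (s≤s ()) _ _

δ : ∀ {n} → Fin n → Fin n → ℕ
δ v a = indicator (does (v ≟ᶠ a))

δ-diag : ∀ {n} (a : Fin n) → δ a a ≡ 1
δ-diag a rewrite dec-true (a ≟ᶠ a) refl = refl

δ-off : ∀ {n} {v a : Fin n} → v ≢ a → δ v a ≡ 0
δ-off {v = v} {a} v≢a rewrite dec-false (v ≟ᶠ a) v≢a = refl

sum-δ* : ∀ {n} (a : Fin n) (g : Fin n → ℕ) → sum (λ v → δ v a * g v) ≡ g a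
sum-δ* a g = trans (sum-single (λ v → δ v a * g v) a (λ v v≢a → cong (_* g v) (δ-off v≢a)))
                   (trans (cong (_* g a) (δ-diag a)) (+-identityʳ (g a)))

sum-one-plus-δ : ∀ {n} (i : Fin n) → sum (λ k → 1 + δ k i) ≡ n + 1
sum-one-plus-δ {n} i = begin
  sum (λ k → 1 + δ k i)                 ≡⟨ ∑-distrib-+ (λ _ → 1) (λ k → δ k i) ⟩
  sum {n} (λ _ → 1) + sum (λ k → δ k i) ≡⟨ cong₂ _+_ (trans (sum-const n 1) (*-identityʳ n)) δ-total ⟩
  n + 1                                 ∎
  where
  open ≡-Reasoning
  δ-total : sum (λ k → δ k i) ≡ 1
  δ-total = trans (sum-cong-≗ (λ k → sym (*-identityʳ (δ k i)))) (sum-δ* i (λ _ → 1))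

-- The window inequality.  (a + (a + s)) x ≤ x² + a (a + s) says (x - a)(x - a - s) ≥ 0.

≤-by-slack : ∀ {m} k {n} → m + k ≡ n → m ≤ n
≤-by-slack {m} k m+k≡n = subst (m ≤_) m+k≡n (m≤m+n m k)

-- The slack p (p + s) at x = a - p and at x = a + s + p.
window-slack-below : ∀ x p s → (x + p + (x + p + s)) * x + p * (p + s) ≡ x * x + (x + p) * (x + p + s)
window-slack-below = solve-∀

window-slack-above : ∀ a s p → (a + (a + s)) * (a + s + p) + p * (p + s) ≡ (a + s + p) * (a + s + p) + a * (a + s)
window-slack-above = solve-∀

-- For s ≤ 1 no natural number lies strictly between the roots a and a + s.
window-≤ : ∀ a s x → s ≤ 1 → (a + (a + s)) * x ≤ x * x + a * (a + s)
window-≤ a s x s≤1 with x ≤? a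
... | yes x≤a with p , refl ← m≤n⇒∃[o]m+o≡n x≤a = ≤-by-slack (p * (p + s)) (window-slack-below x p s)
... | no x≰a
  with p , refl ← m≤n⇒∃[o]m+o≡n (≤-trans (+-monoʳ-≤ a s≤1) (subst (_≤ x) (+-comm 1 a) (≰⇒> x≰a)))
  = ≤-by-slack (p * (p + s)) (window-slack-above a s p)

window-≡ : ∀ a s x → x ≡ a ⊎ x ≡ a + s → (a + (a + s)) * x ≡ x * x + a * (a + s)
window-≡ a s .a       (inj₁ refl) = root-a a s
  where
  root-a : ∀ a s → (a + (a + s)) * a ≡ a * a + a * (a + s)
  root-a = solve-∀
window-≡ a s .(a + s) (inj₂ refl) = root-b a s
  where
  root-b : ∀ a s → (a + (a + s)) * (a + s) ≡ (a + s) * (a + s) + a * (a + s)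
  root-b = solve-∀

other-root : ∀ {x y} a s → x + y ≡ a + (a + s) → y ≡ a ⊎ y ≡ a + s → x ≡ a ⊎ x ≡ a + s
other-root {x} a s sum≡ (inj₁ refl) = inj₂ (+-cancelʳ-≡ a x (a + s) (trans sum≡ (+-comm a (a + s))))
other-root {x} a s sum≡ (inj₂ refl) = inj₁ (+-cancelʳ-≡ (a + s) x a sum≡)

sum-quadratic-≤ : ∀ {n} (d : Fin n → ℕ) c K → (∀ v → c * d v ≤ d v * d v + K) →
                  c * sum d ≤ sum (λ v → d v * d v) + n * K
sum-quadratic-≤ {n} d c K pointwise = begin
  c * sum d                                 ≡⟨ *-distribˡ-sum c d ⟩
  sum (λ v → c * d v)                       ≤⟨ sum-mono-≤ pointwise ⟩
  sum (λ v → d v * d v + K)                 ≡⟨ ∑-distrib-+ (λ v → d v * d v) (λ _ → K) ⟩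
  sum (λ v → d v * d v) + sum {n} (λ _ → K) ≡⟨ cong (sum (λ v → d v * d v) +_) (sum-const n K) ⟩
  sum (λ v → d v * d v) + n * K             ∎
  where open ≤-Reasoning

sum-quadratic-≡ : ∀ {n} (d : Fin n → ℕ) c K → (∀ v → c * d v ≡ d v * d v + K) →
                  c * sum d ≡ sum (λ v → d v * d v) + n * K
sum-quadratic-≡ {n} d c K pointwise = begin
  c * sum d                                 ≡⟨ *-distribˡ-sum c d ⟩
  sum (λ v → c * d v)                       ≡⟨ sum-cong-≗ pointwise ⟩
  sum (λ v → d v * d v + K)                 ≡⟨ ∑-distrib-+ (λ v → d v * d v) (λ _ → K) ⟩
  sum (λ v → d v * d v) + sum {n} (λ _ → K) ≡⟨ cong (sum (λ v → d v * d v) +_) (sum-const n K) ⟩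
  sum (λ v → d v * d v) + n * K             ∎
  where open ≡-Reasoning

both-ends : ∀ {n} {a b : Fin n} (e : Edge n) → a ≢ b → Ends e a → Ends e b → SameEdge (a , b) e
both-ends e a≢b (inj₁ refl) (inj₁ refl) = ⊥-elim (a≢b refl)
both-ends e a≢b (inj₁ a≡)   (inj₂ b≡)   = inj₁ (a≡ , b≡)
both-ends e a≢b (inj₂ a≡)   (inj₁ b≡)   = inj₂ (a≡ , b≡)
both-ends e a≢b (inj₂ refl) (inj₂ refl) = ⊥-elim (a≢b refl)

module RSPartition {n r t : ℕ} {G : Graph n} {M : Fin t → Fin r → Edge n}
                   (rs : IsRSPartition G r t M) where
  open IsRSPartition rs

  endA endB : Fin t → Fin r → Fin n
  endA i j = proj₁ (M i j)
  endB i j = proj₂ (M i j)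

  incidence : Fin t → Fin r → Fin n → ℕ
  incidence i j v = δ v (endA i j) + δ v (endB i j)

  deg-in : Fin t → Fin n → ℕ
  deg-in i v = sum (λ j → incidence i j v)

  -- number of edges of all matchings at v, i.e. the degree of v
  deg : Fin n → ℕ
  deg v = sum (λ i → deg-in i v)

  endpoints-distinct : ∀ i j → endA i j ≢ endB i j
  endpoints-distinct i j a≡b = irrefl G (subst (Adj G (endA i j)) (sym a≡b) (inG i j))

  degree-weighted : ∀ (g : Fin n → ℕ) →
    sum (λ v → deg v * g v) ≡ sum (λ i → sum (λ j → g (endA i j) + g (endB i j)))
  degree-weighted g = begin
    sum (λ v → deg v * g v)                                   ≡⟨ sum-cong-≗ expand ⟩
    sum (λ v → sum (λ i → sum (λ j → incidence i j v * g v)))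
      ≡⟨ ∑-comm (λ v i → sum (λ j → incidence i j v * g v)) ⟩
    sum (λ i → sum (λ v → sum (λ j → incidence i j v * g v)))
      ≡⟨ sum-cong-≗ (λ i → ∑-comm (λ v j → incidence i j v * g v)) ⟩
    sum (λ i → sum (λ j → sum (λ v → incidence i j v * g v)))
      ≡⟨ sum-cong-≗ (λ i → sum-cong-≗ (λ j → edge-weight i j)) ⟩
    sum (λ i → sum (λ j → g (endA i j) + g (endB i j)))       ∎
    where
    open ≡-Reasoning
    expand : ∀ v → deg v * g v ≡ sum (λ i → sum (λ j → incidence i j v * g v))
    expand v = trans (*-distribʳ-sum (g v) (λ i → deg-in i v))
                     (sum-cong-≗ (λ i → *-distribʳ-sum (g v) (λ j → incidence i j v)))
    edge-weight : ∀ i j → sum (λ v → incidence i j v * g v) ≡ g (endA i j) + g (endB i j)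
    edge-weight i j = trans (sum-cong-≗ (λ v → *-distribʳ-+ (g v) (δ v (endA i j)) (δ v (endB i j))))
                     (trans (∑-distrib-+ (λ v → δ v (endA i j) * g v) (λ v → δ v (endB i j) * g v))
                            (cong₂ _+_ (sum-δ* (endA i j) g) (sum-δ* (endB i j) g)))

  handshake : sum deg ≡ t * (r * 2)
  handshake = begin
    sum deg                                 ≡⟨ sum-cong-≗ (λ v → sym (*-identityʳ (deg v))) ⟩
    sum (λ v → deg v * 1)                   ≡⟨ degree-weighted (λ _ → 1) ⟩
    sum {t} (λ i → sum {r} (λ j → 2))       ≡⟨ sum-const₂ t r 2 ⟩
    t * (r * 2)                             ∎
    where open ≡-Reasoning

  sum-deg² : sum (λ v → deg v * deg v) ≡ sum (λ i → sum (λ j → deg (endA i j) + deg (endB i j)))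
  sum-deg² = degree-weighted deg

  incidence-≤1 : ∀ i j v → incidence i j v ≤ 1
  incidence-≤1 i j v with v ≟ᶠ endA i j | v ≟ᶠ endB i j
  ... | yes refl | yes v≡b = ⊥-elim (endpoints-distinct i j v≡b)
  ... | yes _    | no _    = ≤-refl
  ... | no _     | yes _   = ≤-refl
  ... | no _     | no _    = z≤n

  incidence⇒Ends : ∀ i j v → 1 ≤ incidence i j v → Ends (M i j) v
  incidence⇒Ends i j v pos with v ≟ᶠ endA i j | v ≟ᶠ endB i j
  ... | yes v≡a | _       = inj₁ v≡a
  ... | no _    | yes v≡b = inj₂ v≡b
  ... | no _    | no _    with () ← pos

  Ends⇒incidence : ∀ i j v → Ends (M i j) v → 1 ≤ incidence i j v
  Ends⇒incidence i j v (inj₁ refl) = subst (λ x → 1 ≤ x + δ v (endB i j)) (sym (δ-diag v)) (s≤s z≤n)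
  Ends⇒incidence i j v (inj₂ refl) = subst (λ x → 1 ≤ δ v (endA i j) + x) (sym (δ-diag v)) (m≤n+m 1 _)

  deg-in-≤1 : ∀ i v → deg-in i v ≤ 1
  deg-in-≤1 i v = sum-≤1 (λ j → incidence i j v) (λ j → incidence-≤1 i j v) same-edge
    where
    same-edge : ∀ j k → 1 ≤ incidence i j v → 1 ≤ incidence i k v → j ≡ k
    same-edge j k p q with j ≟ᶠ k
    ... | yes j≡k = j≡k
    ... | no j≢k  = ⊥-elim (matching i j k j≢k v (incidence⇒Ends i j v p) (incidence⇒Ends i k v q))

  deg-in⇒Ends : ∀ i v → 1 ≤ deg-in i v → ∃ λ j → Ends (M i j) v
  deg-in⇒Ends i v pos =
    Product.map (λ j → j) (incidence⇒Ends i _ v) (sum-positive (λ j → incidence i j v) pos)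

  Ends⇒deg-in : ∀ i j v → Ends (M i j) v → 1 ≤ deg-in i v
  Ends⇒deg-in i j v e = ≤-trans (Ends⇒incidence i j v e) (term-≤-sum (λ k → incidence i k v) j)

  -- No matching other than the i-th touches both ends of an edge of the i-th one: the two
  -- edges doing so would be joined by an edge of G (against inducedness) or, if they are
  -- the same edge, it would lie in two matchings (against disjointness).
  other-matching-misses : ∀ i j i′ → i′ ≢ i →
    1 ≤ deg-in i′ (endA i j) → 1 ≤ deg-in i′ (endB i j) → ⊥
  other-matching-misses i j i′ i′≢i pa pb
    with deg-in⇒Ends i′ (endA i j) pa | deg-in⇒Ends i′ (endB i j) pb
  ... | k , a∈k | l , b∈l with k ≟ᶠ l
  ... | no k≢l   = induced i′ k l k≢l _ _ a∈k b∈l (inG i j)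
  ... | yes refl = disjoint i i′ j k (λ i≡i′ → i′≢i (sym i≡i′))
                     (both-ends (M i′ k) (endpoints-distinct i j) a∈k b∈l)

  deg-in-ends-≤ : ∀ i j i′ → deg-in i′ (endA i j) + deg-in i′ (endB i j) ≤ 1 + δ i′ i
  deg-in-ends-≤ i j i′ with i′ ≟ᶠ i
  ... | yes _    = +-mono-≤ (deg-in-≤1 i′ (endA i j)) (deg-in-≤1 i′ (endB i j))
  ... | no i′≢i  = exclusive-≤1 (deg-in-≤1 i′ (endA i j)) (deg-in-≤1 i′ (endB i j))
                     (other-matching-misses i j i′ i′≢i)

  edge-degree-≤ : ∀ i j → deg (endA i j) + deg (endB i j) ≤ t + 1
  edge-degree-≤ i j = begin
    deg (endA i j) + deg (endB i j)
      ≡⟨ sym (∑-distrib-+ (λ i′ → deg-in i′ (endA i j)) (λ i′ → deg-in i′ (endB i j))) ⟩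
    sum (λ i′ → deg-in i′ (endA i j) + deg-in i′ (endB i j))   ≤⟨ sum-mono-≤ (deg-in-ends-≤ i j) ⟩
    sum (λ i′ → 1 + δ i′ i)                                    ≡⟨ sum-one-plus-δ i ⟩
    t + 1                                                      ∎
    where open ≤-Reasoning

  sum-deg²-≤ : sum (λ v → deg v * deg v) ≤ t * (r * (t + 1))
  sum-deg²-≤ = begin
    sum (λ v → deg v * deg v)                                   ≡⟨ sum-deg² ⟩
    sum (λ i → sum (λ j → deg (endA i j) + deg (endB i j)))     ≤⟨ sum-mono-≤ (λ i → sum-mono-≤ (edge-degree-≤ i)) ⟩
    sum {t} (λ i → sum {r} (λ j → t + 1))                       ≡⟨ sum-const₂ t r (t + 1) ⟩
    t * (r * (t + 1))                                           ∎
    where open ≤-Reasoning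

  scaled-handshake : (t + 1) * sum deg ≡ t * (r * (t + 1)) + t * (r * (t + 1))
  scaled-handshake = trans (cong ((t + 1) *_) handshake) (double t r)
    where
    double : ∀ t r → (t + 1) * (t * (r * 2)) ≡ t * (r * (t + 1)) + t * (r * (t + 1))
    double = solve-∀

  -- Sum the window inequality over the degrees and compare
  -- with the bound on the sum of squared degrees.
  window-bound : ∀ a s → s ≤ 1 → a + (a + s) ≡ t + 1 → t * (r * (t + 1)) ≤ n * (a * (a + s))
  window-bound a s s≤1 window = +-cancelˡ-≤ E _ _ (begin
    E + E                                      ≡⟨ sym scaled-handshake ⟩
    (t + 1) * sum deg                          ≡⟨ cong (_* sum deg) (sym window) ⟩
    (a + (a + s)) * sum deg                    ≤⟨ sum-quadratic-≤ deg (a + (a + s)) _ (λ v → window-≤ a s (deg v) s≤1) ⟩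
    sum (λ v → deg v * deg v) + n * (a * (a + s)) ≤⟨ +-monoˡ-≤ _ sum-deg²-≤ ⟩
    E + n * (a * (a + s))                      ∎)
    where
    open ≤-Reasoning
    E : ℕ
    E = t * (r * (t + 1))

-- Finite enumerations: a decidable subset of a type with a duplicate-free complete list
-- is numbered by some Fin size.

lookup-injective : ∀ {A : Set} {xs : List A} → Unique xs →
                   ∀ u w → List.lookup xs u ≡ List.lookup xs w → u ≡ w
lookup-injective (_ ∷ _)      zero    zero    _ = refl
lookup-injective (x∉xs ∷ _)   zero    (suc w) e = ⊥-elim (All.lookup x∉xs (∈-lookup w) e)
lookup-injective (x∉xs ∷ _)   (suc u) zero    e = ⊥-elim (All.lookup x∉xs (∈-lookup u) (sym e))
lookup-injective (_ ∷ unique) (suc u) (suc w) e = cong suc (lookup-injective unique u w e)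

record Listing (A : Set) : Set where
  field
    elements : List A
    unique   : Unique elements
    complete : ∀ x → x ∈ elements

listing-Bool : Listing Bool
listing-Bool = record
  { elements = true ∷ false ∷ []
  ; unique   = ((λ ()) All.∷ All.[]) ∷ All.[] ∷ []
  ; complete = λ { true → here refl ; false → there (here refl) } }

listing-Fin : ∀ m → Listing (Fin m)
listing-Fin m = record { elements = allFin m ; unique = Unique.allFin⁺ m ; complete = ∈-allFin }

listing-× : ∀ {A B : Set} → Listing A → Listing B → Listing (A × B)
listing-× LA LB = record
  { elements = cartesianProduct (elements LA) (elements LB)
  ; unique   = Unique.cartesianProduct⁺ (unique LA) (unique LB)
  ; complete = λ (x , y) → ∈-cartesianProduct⁺ (complete LA x) (complete LB y) }
  where open Listing

listing-Vec : ∀ {A : Set} → Listing A → ∀ T → Listing (Vec A T)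
listing-Vec LA zero    = record { elements = [] ∷ [] ; unique = All.[] ∷ [] ; complete = λ { [] → here refl } }
listing-Vec {A} LA (suc T) = record
  { elements = cartesianProductWith _∷_ (elements LA) (elements LV)
  ; unique   = Unique.cartesianProductWith⁺ _∷_ ∷-injective (unique LA) (unique LV)
  ; complete = λ { (x ∷ xs) → ∈-cartesianProductWith⁺ _∷_ (complete LA x) (complete LV xs) } }
  where
  open Listing
  LV : Listing (Vec A T)
  LV = listing-Vec LA T

record Enumeration {A : Set} (P : A → Set) : Set where
  field
    size       : ℕ
    elem       : Fin size → A
    elem-valid : ∀ w → P (elem w)
    index      : ∀ x → P x → Fin size
    elem-index : ∀ x p → elem (index x p) ≡ x
    elem-injective : ∀ u w → elem u ≡ elem w → u ≡ w

  index-unique : ∀ x p w → elem w ≡ x → index x p ≡ w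
  index-unique x p w e = elem-injective _ _ (trans (elem-index x p) (sym e))

enumerate : ∀ {A : Set} {P : A → Set} → Listing A → Decidable P → Enumeration P
enumerate {A} {P} LA P? = record
  { size = length xs
  ; elem = List.lookup xs
  ; elem-valid = λ w → proj₂ (∈-filter⁻ P? {xs = elements} (∈-lookup w))
  ; index = λ x p → Any.index (mem x p)
  ; elem-index = λ x p → sym (lookup-index (mem x p))
  ; elem-injective = lookup-injective (Unique.filter⁺ P? unique)
  }
  where
  open Listing LA
  xs : List A
  xs = filter P? elements
  mem : ∀ x → P x → x ∈ xs
  mem x p = ∈-filter⁺ P? (complete x) p

vec-ext : ∀ {A : Set} {T} {L L′ : Vec A T} → (∀ k → lookup L k ≡ lookup L′ k) → L ≡ L′
vec-ext pointwise = Pointwise-≡⇒≡ (ext pointwise)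

count : ∀ {T} → Vec Bool T → ℕ
count L = sum (λ k → indicator (lookup L k))

count-replicate-false : ∀ T → count (replicate T false) ≡ 0
count-replicate-false zero    = refl
count-replicate-false (suc T) = count-replicate-false T

vector-with-count : ∀ T a → a ≤ T → Σ (Vec Bool T) λ L → count L ≡ a
vector-with-count T       zero    _         = replicate T false , count-replicate-false T
vector-with-count (suc T) (suc a) (s≤s a≤T) with L , count≡a ← vector-with-count T a a≤T =
  true ∷ L , cong suc count≡a

permute : ∀ {A : Set} {T} → Permutation T T → Vec A T → Vec A T
permute π L = tabulate (λ k → lookup L (π ⟨$⟩ʳ k))

lookup-permute : ∀ {A : Set} {T} (π : Permutation T T) (L : Vec A T) k →
                 lookup (permute π L) k ≡ lookup L (π ⟨$⟩ʳ k)
lookup-permute π L = lookup∘tabulate (λ k → lookup L (π ⟨$⟩ʳ k))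

permute-flip-permute : ∀ {A : Set} {T} (π : Permutation T T) (L : Vec A T) →
                       permute (flip π) (permute π L) ≡ L
permute-flip-permute π L = vec-ext λ k →
  trans (lookup-permute (flip π) (permute π L) k) (trans (lookup-permute π L _) (cong (lookup L) (inverseʳ π)))

permute-permute-flip : ∀ {A : Set} {T} (π : Permutation T T) (L : Vec A T) →
                       permute π (permute (flip π) L) ≡ L
permute-permute-flip π L = vec-ext λ k →
  trans (lookup-permute π (permute (flip π) L) k) (trans (lookup-permute (flip π) L _) (cong (lookup L) (inverseˡ π)))

count-permute : ∀ {T} (π : Permutation T T) (L : Vec Bool T) → count (permute π L) ≡ count L
count-permute π L = trans (sum-cong-≗ (λ k → cong indicator (lookup-permute π L k)))
                          (sym (∑-permute (λ k → indicator (lookup L k)) π))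

swap₀ : ∀ {T} → Fin (suc T) → Permutation (suc T) (suc T)
swap₀ i = transpose zero i

swap₀-at : ∀ {T} (i : Fin (suc T)) → swap₀ i ⟨$⟩ʳ i ≡ zero
swap₀-at zero    = refl
swap₀-at (suc i) rewrite dec-true (suc i ≟ᶠ suc i) refl = refl

swap₀⁻¹-zero : ∀ {T} (i : Fin (suc T)) → flip (swap₀ i) ⟨$⟩ʳ zero ≡ i
swap₀⁻¹-zero zero    = refl
swap₀⁻¹-zero (suc i) = refl

flip-except : ∀ {T} → Fin T → Vec Bool T → Vec Bool T
flip-except i L = tabulate (λ k → if does (k ≟ᶠ i) then true else not (lookup L k))

flip-except-at : ∀ {T} (i : Fin T) L → lookup (flip-except i L) i ≡ true
flip-except-at i L rewrite lookup∘tabulate (λ k → if does (k ≟ᶠ i) then true else not (lookup L k)) i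
                         | dec-true (i ≟ᶠ i) refl = refl

flip-except-off : ∀ {T} (i : Fin T) L {k} → k ≢ i → lookup (flip-except i L) k ≡ not (lookup L k)
flip-except-off i L {k} k≢i rewrite lookup∘tabulate (λ k → if does (k ≟ᶠ i) then true else not (lookup L k)) k
                                  | dec-false (k ≟ᶠ i) k≢i = refl

flip-except-involutive : ∀ {T} (i : Fin T) L → lookup L i ≡ true → flip-except i (flip-except i L) ≡ L
flip-except-involutive i L Lᵢ = vec-ext pointwise
  where
  pointwise : ∀ k → lookup (flip-except i (flip-except i L)) k ≡ lookup L k
  pointwise k with k ≟ᶠ i
  ... | yes refl = trans (flip-except-at i (flip-except i L)) (sym Lᵢ)
  ... | no k≢i   = trans (flip-except-off i (flip-except i L) k≢i)
                         (trans (cong not (flip-except-off i L k≢i)) (not-involutive _))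

count-flip-except : ∀ {T} (i : Fin T) L → lookup L i ≡ true → count (flip-except i L) + count L ≡ T + 1
count-flip-except {T} i L Lᵢ = begin
  count (flip-except i L) + count L
    ≡⟨ sym (∑-distrib-+ (λ k → indicator (lookup (flip-except i L) k)) (λ k → indicator (lookup L k))) ⟩
  sum (λ k → indicator (lookup (flip-except i L) k) + indicator (lookup L k)) ≡⟨ sum-cong-≗ pointwise ⟩
  sum (λ k → 1 + δ k i)                                             ≡⟨ sum-one-plus-δ i ⟩
  T + 1                                                             ∎
  where
  open ≡-Reasoning
  complement : ∀ b → indicator (not b) + indicator b ≡ 1
  complement true  = refl
  complement false = refl
  pointwise : ∀ k → indicator (lookup (flip-except i L) k) + indicator (lookup L k) ≡ 1 + δ k i
  pointwise k with k ≟ᶠ i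
  ... | yes refl = cong₂ (λ x y → indicator x + indicator y) (flip-except-at i L) Lᵢ
  ... | no k≢i   = trans (cong (λ x → indicator x + indicator (lookup L k)) (flip-except-off i L k≢i))
                         (complement (lookup L k))

-- The extremal construction for t = T = suc t′ and a window a + (a + s) = T + 1, with m
-- copies of everything.
module Construction (t′ m a s : ℕ) (window : a + (a + s) ≡ suc t′ + 1) (a≤T : a ≤ suc t′) where

  T : ℕ
  T = suc t′

  Code : Set
  Code = Vec Bool T

  Balanced : Code → Set
  Balanced L = count L ≡ a ⊎ count L ≡ a + s

  balanced? : Decidable Balanced
  balanced? L = (count L ≟ℕ a) ⊎-dec (count L ≟ℕ a + s)

  balanced-permute : ∀ π L → Balanced L → Balanced (permute π L)
  balanced-permute π L = subst (λ c → c ≡ a ⊎ c ≡ a + s) (sym (count-permute π L))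

  balanced-flip-except : ∀ i L → lookup L i ≡ true → Balanced L → Balanced (flip-except i L)
  balanced-flip-except i L Lᵢ = other-root a s (trans (count-flip-except i L Lᵢ) (sym window))

  -- A vertex is a code, a side and one of m copies; the graph uses the balanced ones.
  Vertex : Set
  Vertex = Code × Bool × Fin m

  code : Vertex → Code
  code = proj₁

  side : Vertex → Bool
  side X = proj₁ (proj₂ X)

  copy : Vertex → Fin m
  copy X = proj₂ (proj₂ X)

  partner : Fin T → Vertex → Vertex
  partner i (L , b , x) = flip-except i L , not b , x

  partner-at : ∀ i X → lookup (code (partner i X)) i ≡ true
  partner-at i X = flip-except-at i (code X)

  partner-involutive : ∀ i X → lookup (code X) i ≡ true → partner i (partner i X) ≡ X
  partner-involutive i (L , b , x) Lᵢ = cong₂ _,_ (flip-except-involutive i L Lᵢ) (cong (_, x) (not-involutive b))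

  Adjacent : Vertex → Vertex → Set
  Adjacent X Y = ∃ λ i → lookup (code X) i ≡ true × Y ≡ partner i X

  adjacent-sym : ∀ {X Y} → Adjacent X Y → Adjacent Y X
  adjacent-sym {X} (i , Xᵢ , refl) = i , partner-at i X , sym (partner-involutive i X Xᵢ)

  adjacent-irrefl : ∀ {X} → ¬ Adjacent X X
  adjacent-irrefl {L , b , x} (i , _ , X≡) = not-fixed b (cong side X≡)
    where
    not-fixed : ∀ b → b ≢ not b
    not-fixed true  ()
    not-fixed false ()

  adjacent-across : ∀ {X Y} i → Adjacent X Y → lookup (code X) i ≡ true → lookup (code Y) i ≡ true →
                    Y ≡ partner i X
  adjacent-across {X} i (i′ , _ , refl) Xᵢ Yᵢ with i ≟ᶠ i′
  ... | yes refl = refl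
  ... | no i≢i′  with () ← trans (sym Yᵢ) (trans (flip-except-off i′ (code X) i≢i′) (cong not Xᵢ))

  opaque
    vertices : Enumeration (λ X → Balanced (code X))
    vertices = enumerate (listing-× (listing-Vec listing-Bool T) (listing-× listing-Bool (listing-Fin m)))
                         (λ X → balanced? (code X))

  open Enumeration vertices public using () renaming
    (size to n; elem to vertex; elem-valid to vertex-balanced; index to vertex-index;
     elem-index to vertex-index-inverse; index-unique to vertex-index-unique)

  G : Graph n
  G = record { Adj = λ u w → Adjacent (vertex u) (vertex w) ; sym = adjacent-sym ; irrefl = adjacent-irrefl }

  -- The edges of every matching are indexed by the balanced codes with coordinate 0 set,
  -- together with a copy; matching i moves coordinate 0 to i.
  opaque
    representatives : Enumeration (λ (p : Code × Fin m) → Balanced (proj₁ p) × lookup (proj₁ p) zero ≡ true)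
    representatives = enumerate (listing-× (listing-Vec listing-Bool T) (listing-Fin m))
                                (λ p → balanced? (proj₁ p) ×-dec (lookup (proj₁ p) zero ≟ᵇ true))

  open Enumeration representatives public using () renaming
    (size to r; elem to rep; elem-valid to rep-valid; index to rep-index;
     elem-index to rep-index-inverse; elem-injective to rep-injective)

  tail head : Fin T → Fin r → Vertex
  tail i j = permute (swap₀ i) (proj₁ (rep j)) , true , proj₂ (rep j)
  head i j = partner i (tail i j)

  tail-at : ∀ i j → lookup (code (tail i j)) i ≡ true
  tail-at i j = trans (lookup-permute (swap₀ i) (proj₁ (rep j)) i)
                      (trans (cong (lookup (proj₁ (rep j))) (swap₀-at i)) (proj₂ (rep-valid j)))

  tail-balanced : ∀ i j → Balanced (code (tail i j))
  tail-balanced i j = balanced-permute (swap₀ i) (proj₁ (rep j)) (proj₁ (rep-valid j))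

  head-balanced : ∀ i j → Balanced (code (head i j))
  head-balanced i j = balanced-flip-except i (code (tail i j)) (tail-at i j) (tail-balanced i j)

  M : Fin T → Fin r → Edge n
  M i j = vertex-index (tail i j) (tail-balanced i j) , vertex-index (head i j) (head-balanced i j)

  OnEdge : Fin T → Fin r → Vertex → Set
  OnEdge i j X = X ≡ tail i j ⊎ X ≡ head i j

  Ends⇒OnEdge : ∀ i j u → Ends (M i j) u → OnEdge i j (vertex u)
  Ends⇒OnEdge i j u (inj₁ refl) = inj₁ (vertex-index-inverse (tail i j) (tail-balanced i j))
  Ends⇒OnEdge i j u (inj₂ refl) = inj₂ (vertex-index-inverse (head i j) (head-balanced i j))

  OnEdge⇒Ends : ∀ i j u → OnEdge i j (vertex u) → Ends (M i j) u
  OnEdge⇒Ends i j u (inj₁ u≡) = inj₁ (sym (vertex-index-unique _ (tail-balanced i j) u u≡))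
  OnEdge⇒Ends i j u (inj₂ u≡) = inj₂ (sym (vertex-index-unique _ (head-balanced i j) u u≡))

  OnEdge-at : ∀ i j X → OnEdge i j X → lookup (code X) i ≡ true
  OnEdge-at i j X (inj₁ refl) = tail-at i j
  OnEdge-at i j X (inj₂ refl) = partner-at i (tail i j)

  OnEdge-partner : ∀ i j X → OnEdge i j X → OnEdge i j (partner i X)
  OnEdge-partner i j X (inj₁ refl) = inj₂ refl
  OnEdge-partner i j X (inj₂ refl) = inj₁ (partner-involutive i (tail i j) (tail-at i j))

  tail-injective : ∀ i j k → tail i j ≡ tail i k → j ≡ k
  tail-injective i j k tails≡ = rep-injective j k (cong₂ _,_ codes≡ (cong copy tails≡))
    where
    codes≡ : proj₁ (rep j) ≡ proj₁ (rep k)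
    codes≡ = trans (sym (permute-flip-permute (swap₀ i) (proj₁ (rep j))))
                   (trans (cong (λ X → permute (flip (swap₀ i)) (code X)) tails≡)
                          (permute-flip-permute (swap₀ i) (proj₁ (rep k))))

  OnEdge-unique : ∀ i j k X → OnEdge i j X → OnEdge i k X → j ≡ k
  OnEdge-unique i j k X (inj₁ refl) (inj₁ X≡) = tail-injective i j k X≡
  OnEdge-unique i j k X (inj₂ refl) (inj₂ X≡) =
    tail-injective i j k (trans (sym (partner-involutive i (tail i j) (tail-at i j)))
                         (trans (cong (partner i) X≡) (partner-involutive i (tail i k) (tail-at i k))))
  OnEdge-unique i j k X (inj₁ refl) (inj₂ X≡) with () ← cong side X≡
  OnEdge-unique i j k X (inj₂ refl) (inj₁ X≡) with () ← cong side X≡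

  tail-exists : ∀ i L x → lookup L i ≡ true → Balanced L → ∃ λ j → tail i j ≡ (L , true , x)
  tail-exists i L x Lᵢ bal = j , cong₂ _,_ code≡ (cong (true ,_) (cong proj₂ rep≡))
    where
    L₀ : Code
    L₀ = permute (flip (swap₀ i)) L
    valid : Balanced L₀ × lookup L₀ zero ≡ true
    valid = balanced-permute (flip (swap₀ i)) L bal ,
            trans (lookup-permute (flip (swap₀ i)) L zero) (trans (cong (lookup L) (swap₀⁻¹-zero i)) Lᵢ)
    j : Fin r
    j = rep-index (L₀ , x) valid
    rep≡ : rep j ≡ (L₀ , x)
    rep≡ = rep-index-inverse (L₀ , x) valid
    code≡ : permute (swap₀ i) (proj₁ (rep j)) ≡ L
    code≡ = trans (cong (λ p → permute (swap₀ i) (proj₁ p)) rep≡) (permute-permute-flip (swap₀ i) L)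

  OnEdge-exists : ∀ i X → lookup (code X) i ≡ true → Balanced (code X) → ∃ λ j → OnEdge i j X
  OnEdge-exists i (L , true , x) Lᵢ bal =
    Product.map (λ j → j) (λ tail≡ → inj₁ (sym tail≡)) (tail-exists i L x Lᵢ bal)
  OnEdge-exists i (L , false , x) Lᵢ bal =
    Product.map (λ j → j)
                (λ tail≡ → inj₂ (sym (trans (cong (partner i) tail≡) (partner-involutive i (L , false , x) Lᵢ))))
                (tail-exists i (flip-except i L) x (flip-except-at i L) (balanced-flip-except i L Lᵢ bal))

  same-index : ∀ {X Y} p q → vertex-index X p ≡ vertex-index Y q → X ≡ Y
  same-index {X} {Y} p q e =
    trans (sym (vertex-index-inverse X p)) (trans (cong vertex e) (vertex-index-inverse Y q))

  -- Edges of distinct matchings never coincide: a common tail has, across i′, a partner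
  -- with coordinate i cleared, while its partner across i has it set.
  partners-differ : ∀ i i′ j j′ → i ≢ i′ → tail i j ≡ tail i′ j′ → head i j ≢ head i′ j′
  partners-differ i i′ j j′ i≢i′ tails≡ heads≡ = true≢false (begin
    true                                 ≡⟨ sym (partner-at i (tail i j)) ⟩
    lookup (code (head i j)) i           ≡⟨ cong (λ X → lookup (code X) i) heads≡ ⟩
    lookup (code (head i′ j′)) i         ≡⟨ flip-except-off i′ (code (tail i′ j′)) i≢i′ ⟩
    not (lookup (code (tail i′ j′)) i)   ≡⟨ cong (λ X → not (lookup (code X) i)) (sym tails≡) ⟩
    not (lookup (code (tail i j)) i)     ≡⟨ cong not (tail-at i j) ⟩
    false                                ∎)
    where
    open ≡-Reasoning
    true≢false : true ≢ false
    true≢false ()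

  tail≢head : ∀ i i′ j j′ → tail i j ≢ head i′ j′
  tail≢head i i′ j j′ e with () ← cong side e

  isRS : IsRSPartition G r T M
  isRS = record
    { inG      = λ i j → subst₂ Adjacent (sym (vertex-index-inverse (tail i j) (tail-balanced i j)))
                                         (sym (vertex-index-inverse (head i j) (head-balanced i j)))
                                         (i , tail-at i j , refl)
    ; matching = λ i j k j≢k v v∈j v∈k →
                   j≢k (OnEdge-unique i j k (vertex v) (Ends⇒OnEdge i j v v∈j) (Ends⇒OnEdge i k v v∈k))
    ; induced  = induced
    ; disjoint = disjoint
    ; cover    = cover
    }
    where
    -- adjacent ends of edges j, k of matching i are partners across i, hence on one edge
    induced : ∀ i j k → j ≢ k → ∀ u w → Ends (M i j) u → Ends (M i k) w → ¬ Adjacent (vertex u) (vertex w)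
    induced i j k j≢k u w u∈j w∈k adj = j≢k (OnEdge-unique i j k (vertex w) w∈j′ w∈k′)
      where
      u∈j′ : OnEdge i j (vertex u)
      u∈j′ = Ends⇒OnEdge i j u u∈j
      w∈k′ : OnEdge i k (vertex w)
      w∈k′ = Ends⇒OnEdge i k w w∈k
      w≡ : vertex w ≡ partner i (vertex u)
      w≡ = adjacent-across {vertex u} {vertex w} i adj (OnEdge-at i j (vertex u) u∈j′) (OnEdge-at i k (vertex w) w∈k′)
      w∈j′ : OnEdge i j (vertex w)
      w∈j′ = subst (OnEdge i j) (sym w≡) (OnEdge-partner i j (vertex u) u∈j′)

    disjoint : ∀ i i′ j j′ → i ≢ i′ → ¬ SameEdge (M i j) (M i′ j′)
    disjoint i i′ j j′ i≢i′ (inj₁ (tails≡ , heads≡)) =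
      partners-differ i i′ j j′ i≢i′ (same-index (tail-balanced i j) (tail-balanced i′ j′) tails≡)
                                     (same-index (head-balanced i j) (head-balanced i′ j′) heads≡)
    disjoint i i′ j j′ i≢i′ (inj₂ (tail≡head , _)) =
      tail≢head i i′ j j′ (same-index (tail-balanced i j) (head-balanced i′ j′) tail≡head)

    -- an edge across i at u is the edge of matching i on which u lies
    cover : ∀ u w → Adjacent (vertex u) (vertex w) → ∃ λ i → ∃ λ j → SameEdge (M i j) (u , w)
    cover u w (i , uᵢ , w≡) = i , Product.map (λ j → j) same-edge (OnEdge-exists i (vertex u) uᵢ (vertex-balanced u))
      where
      same-edge : ∀ {j} → OnEdge i j (vertex u) → SameEdge (M i j) (u , w)
      same-edge {j} (inj₁ u≡) =
        inj₁ (vertex-index-unique (tail i j) (tail-balanced i j) u u≡ ,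
              vertex-index-unique (head i j) (head-balanced i j) w (trans w≡ (cong (partner i) u≡)))
      same-edge {j} (inj₂ u≡) =
        inj₂ (vertex-index-unique (tail i j) (tail-balanced i j) w
                (trans w≡ (trans (cong (partner i) u≡) (partner-involutive i (tail i j) (tail-at i j)))) ,
              vertex-index-unique (head i j) (head-balanced i j) u u≡)

  open RSPartition isRS using (deg-in; deg; deg-in-≤1; deg-in⇒Ends; Ends⇒deg-in; endA; endB; sum-deg²; scaled-handshake)

  deg-in-value : ∀ i v → deg-in i v ≡ indicator (lookup (code (vertex v)) i)
  deg-in-value i v = indicator-of (lookup (code (vertex v)) i) (deg-in-≤1 i v) covered⇒set set⇒covered
    where
    covered⇒set : 1 ≤ deg-in i v → lookup (code (vertex v)) i ≡ true
    covered⇒set pos = let (j , v∈j) = deg-in⇒Ends i v pos in OnEdge-at i j (vertex v) (Ends⇒OnEdge i j v v∈j)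
    set⇒covered : lookup (code (vertex v)) i ≡ true → 1 ≤ deg-in i v
    set⇒covered vᵢ = let (j , v∈j) = OnEdge-exists i (vertex v) vᵢ (vertex-balanced v)
                     in Ends⇒deg-in i j v (OnEdge⇒Ends i j v v∈j)

  deg-value : ∀ v → deg v ≡ count (code (vertex v))
  deg-value v = sum-cong-≗ (λ i → deg-in-value i v)

  deg-balanced : ∀ v → deg v ≡ a ⊎ deg v ≡ a + s
  deg-balanced v = subst (λ c → c ≡ a ⊎ c ≡ a + s) (sym (deg-value v)) (vertex-balanced v)

  edge-degree-≡ : ∀ i j → deg (endA i j) + deg (endB i j) ≡ T + 1
  edge-degree-≡ i j = begin
    deg (endA i j) + deg (endB i j)                 ≡⟨ cong₂ _+_ (deg-value (endA i j)) (deg-value (endB i j)) ⟩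
    count (code (vertex (endA i j))) + count (code (vertex (endB i j)))
                                                    ≡⟨ cong₂ (λ X Y → count (code X) + count (code Y))
                                                             (vertex-index-inverse (tail i j) (tail-balanced i j))
                                                             (vertex-index-inverse (head i j) (head-balanced i j)) ⟩
    count (code (tail i j)) + count (code (head i j)) ≡⟨ +-comm (count (code (tail i j))) _ ⟩
    count (code (head i j)) + count (code (tail i j)) ≡⟨ count-flip-except i (code (tail i j)) (tail-at i j) ⟩
    T + 1                                           ∎
    where open ≡-Reasoning

  window-equality : T * (r * (T + 1)) ≡ n * (a * (a + s))
  window-equality = +-cancelˡ-≡ E _ _ (begin
    E + E                                          ≡⟨ sym scaled-handshake ⟩
    (T + 1) * sum deg                              ≡⟨ cong (_* sum deg) (sym window) ⟩
    (a + (a + s)) * sum deg                        ≡⟨ sum-quadratic-≡ deg (a + (a + s)) _ (λ v → window-≡ a s (deg v) (deg-balanced v)) ⟩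
    sum (λ v → deg v * deg v) + n * (a * (a + s))  ≡⟨ cong (_+ n * (a * (a + s))) sum-deg²-≡ ⟩
    E + n * (a * (a + s))                          ∎)
    where
    open ≡-Reasoning
    E : ℕ
    E = T * (r * (T + 1))
    sum-deg²-≡ : sum (λ v → deg v * deg v) ≡ E
    sum-deg²-≡ = trans sum-deg² (trans (sum-cong-≗ (λ i → sum-cong-≗ (edge-degree-≡ i))) (sum-const₂ T r (T + 1)))

  -- The m copies of a fixed balanced code give m distinct vertices.
  copies-≤-n : m ≤ n
  copies-≤-n = injective⇒≤ {f = λ x → vertex-index (L₀ , true , x) bal₀} copy-injective
    where
    L₀ : Code
    L₀ = proj₁ (vector-with-count T a a≤T)
    bal₀ : Balanced L₀
    bal₀ = inj₁ (proj₂ (vector-with-count T a a≤T))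
    copy-injective : ∀ {x y} → vertex-index (L₀ , true , x) bal₀ ≡ vertex-index (L₀ , true , y) bal₀ → x ≡ y
    copy-injective e = cong copy (same-index bal₀ bal₀ e)

-- Parity of t and the translation of the uniform bound into the stated one.

data ParityView : ℕ → Set where
  odd  : ∀ k → ParityView (1 + k * 2)
  even : ∀ k → ParityView (k * 2)

parity-view : ∀ t → ParityView t
parity-view zero = even 0
parity-view (suc t) with parity-view t
... | odd k  = even (suc k)
... | even k = odd k

-- Each parity makes one component of RSBound and RSBoundAttained vacuous.
odd-not-even : ∀ k → (1 + k * 2) % 2 ≢ 0
odd-not-even k t%2≡0 with () ← trans (sym ([m+kn]%n≡m%n 1 k 2)) t%2≡0

even-not-odd : ∀ k → (k * 2) % 2 ≢ 1
even-not-odd k t%2≡1 with () ← trans (sym t%2≡1) (m*n%n≡0 k 2)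

Rescalable : (ℕ → ℕ → Set) → Set
Rescalable R = ∀ c {x y} → R (suc c * x) (suc c * y) → R (2 * x) (2 * y)

rescale-≤ : Rescalable _≤_
rescale-≤ c le = *-monoʳ-≤ 2 (*-cancelˡ-≤ (suc c) le)

rescale-≡ : Rescalable _≡_
rescale-≡ c {x} {y} eq = cong (2 *_) (*-cancelˡ-≡ x y (suc c) eq)

-- For odd t = 2k + 1 the window is a = a + s = k + 1, and the uniform bound
-- t r (t + 1) R n (k + 1)² (R being ≤ or ≡) is the stated one times (k + 1)/2.
odd-form : ∀ R → Rescalable R → ∀ k n r → let t = 1 + k * 2 in
           R (t * (r * (t + 1))) (n * (suc k * (suc k + 0))) → R (4 * t * r) (n * (t + 1))
odd-form R rescale k n r uniform =
  subst₂ R (sym (lhs k r)) (sym (rhs k n)) (rescale k (subst₂ R (lhs′ k r) (rhs′ k n) uniform))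
  where
  lhs′ : ∀ k r → (1 + k * 2) * (r * (1 + k * 2 + 1)) ≡ suc k * ((1 + k * 2) * r * 2)
  lhs′ = solve-∀
  rhs′ : ∀ k n → n * (suc k * (suc k + 0)) ≡ suc k * (n * suc k)
  rhs′ = solve-∀
  lhs : ∀ k r → 4 * (1 + k * 2) * r ≡ 2 * ((1 + k * 2) * r * 2)
  lhs = solve-∀
  rhs : ∀ k n → n * (1 + k * 2 + 1) ≡ 2 * (n * suc k)
  rhs = solve-∀

-- For even t = 2k (k ≥ 1) the window is a = k, a + s = k + 1, and the uniform bound
-- t r (t + 1) R n k (k + 1) is the stated one times k/2.
even-form : ∀ R → Rescalable R → ∀ k n r → let t = suc k * 2 in
            R (t * (r * (t + 1))) (n * (suc k * (suc k + 1))) → R (4 * (t + 1) * r) (n * (t + 2))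
even-form R rescale k n r uniform =
  subst₂ R (sym (lhs k r)) (sym (rhs k n)) (rescale k (subst₂ R (lhs′ k r) (rhs′ k n) uniform))
  where
  lhs′ : ∀ k r → suc k * 2 * (r * (suc k * 2 + 1)) ≡ suc k * (2 * r * (suc k * 2 + 1))
  lhs′ = solve-∀
  rhs′ : ∀ k n → n * (suc k * (suc k + 1)) ≡ suc k * (n * (suc k + 1))
  rhs′ = solve-∀
  lhs : ∀ k r → 4 * (suc k * 2 + 1) * r ≡ 2 * (2 * r * (suc k * 2 + 1))
  lhs = solve-∀
  rhs : ∀ k n → n * (suc k * 2 + 2) ≡ 2 * (n * (suc k + 1))
  rhs = solve-∀

odd-window : ∀ k → suc k + (suc k + 0) ≡ suc (k * 2) + 1
odd-window = solve-∀

even-window : ∀ k → suc k + (suc k + 1) ≡ suc k * 2 + 1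
even-window = solve-∀

rs-bound : (n r t : ℕ) (G : Graph n) → 1 ≤ t → IsRS G r t → RSBound n r t
rs-bound n r t G 1≤t (M , rs) with parity-view t
... | odd k        = (λ _ → odd-form _≤_ rescale-≤ k n r (window-bound (suc k) 0 z≤n (odd-window k))) ,
                     (λ t%2≡0 → ⊥-elim (odd-not-even k t%2≡0))
  where open RSPartition rs
... | even zero    with () ← 1≤t
... | even (suc k) = (λ t%2≡1 → ⊥-elim (even-not-odd (suc k) t%2≡1)) ,
                     (λ _ → even-form _≤_ rescale-≤ k n r (window-bound (suc k) 1 ≤-refl (even-window k)))
  where open RSPartition rs

rs-tight : (t : ℕ) → 1 ≤ t → (N : ℕ) →
  ∃ λ n → N ≤ n × (∃ λ r → ∃ λ (G : Graph n) → IsRS G r t × RSBoundAttained n r t)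
rs-tight t 1≤t N with parity-view t
... | odd k        = n , copies-≤-n , r , G , (M , isRS) ,
                     (λ _ → odd-form _≡_ rescale-≡ k n r window-equality) ,
                     (λ t%2≡0 → ⊥-elim (odd-not-even k t%2≡0))
  where open Construction (k * 2) N (suc k) 0 (odd-window k) (s≤s (m≤m*n k 2))
... | even zero    with () ← 1≤t
... | even (suc k) = n , copies-≤-n , r , G , (M , isRS) ,
                     (λ t%2≡1 → ⊥-elim (even-not-odd (suc k) t%2≡1)) ,
                     (λ _ → even-form _≡_ rescale-≡ k n r window-equality)
  where open Construction (suc (k * 2)) N (suc k) 1 (even-window k) (s≤s (≤-trans (m≤m*n k 2) (n≤1+n (k * 2))))

theorem1p1 : ((n r t : ℕ) (G : Graph n) → 1 ≤ t → IsRS G r t → RSBound n r t)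
    × ((t : ℕ) → 1 ≤ t → (N : ℕ) →
        ∃ λ n → N ≤ n × (∃ λ r → ∃ λ (G : Graph n) → IsRS G r t × RSBoundAttained n r t))
theorem1p1 = rs-bound , rs-tight
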